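{- Let $P$ be a partially observable plant, $\beta$ a propositional formula over its state variables, and $D_\varphi$ the belief-automaton diagnoser for $\varphi=\mathrm{ExactDel}(A_\varphi,\beta,0)$. Then $D_\varphi\otimes P\models G([A_\varphi]_o\to\beta)$.
   Context: A plant $P=\langle V^P,E^P,I^P,\mathcal T^P,E^P_o\rangle$ is a labeled transition system: finite set $V^P$ of state variables over a finite domain (finite state set $S$), events $E^P$, initial formula $I^P$, transition formulas $\mathcal T^P(e)$ over $V^P\cup V^{P\prime}$, observable events $E^P_o\subseteq E^P$. A trace is an infinite sequence $\sigma=s_0,e_0,s_1,e_1,\dots$ with $s_0$ initial and consecutive states related by the transition formula of the event in between. Belief automaton: for $b\subseteq S$, $b^*$ is the least superset of $b$ closed under transitions labeled by events in $E^P\setminus E^P_o$; $b_0=\{s\mid s\models I^P\}$; $R(b,e)=\{s'\mid\exists s\in b^*.\ \langle s,s'\rangle\models\mathcal T^P(e)\}$ for $e\in E^P_o$. $D_\varphi$ is the LTS with events $E^P_o$, states the subsets $b\subseteq S$, initial state $b_0$, transitions $b\xrightarrow{e}R(b,e)$, and alarm variable $A_\varphi$ true in $b$ iff all $s\in b$ satisfy $\beta$. $D_\varphi\otimes P$ is the asynchronous product (states $b\times s$; on unobservable events only the plant moves; on observable $e$, $b$ moves to $R(b,e)$ while the plant takes an $e$-transition); $\beta$ is evaluated on the plant component. Logic: $G$ is "at all positions $\ge$ current"; $Y\phi$ at $i$ iff $i>0$ and $\phi$ at $i-1$; $\sigma,i\models e$ iff $e_i=e$; $[\phi]_o$ abbreviates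 $\phi\wedge Y\bigvee_{e\in E^P_o}e$. A system satisfies a formula iff all its traces do at position 0. -}

module Defs where

open import Level using (0ℓ)
open import Data.Nat using (ℕ; zero; suc)
open import Data.Fin using (Fin)
open import Data.Bool using (Bool; true; false; if_then_else_)
open import Data.Product using (∃; _×_)
open import Data.Empty using (⊥)
open import Relation.Unary using (Pred; _≐_)
open import Relation.Binary.PropositionalEquality using (_≡_)

-- States: the finite set of valuations of
-- the state variables, represented as Fin nS.
-- Formulas over V (resp. V ∪ V') are represented semantically as
-- predicates on states (resp. relations on pairs of states).
record Plant : Set₁ where
  field
    nS   : ℕ
    nE   : ℕ
    Init : Pred (Fin nS) 0ℓ
    Tr   : Fin nE → Fin nS → Fin nS → Set
    obs  : Fin nE → Bool

module _ (P : Plant) where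
  open Plant P

  State : Set
  State = Fin nS

  Event : Set
  Event = Fin nE

  Belief : Set₁
  Belief = Pred State 0ℓ

  data Closure (b : Belief) : State → Set where
    base : ∀ {s} → b s → Closure b s
    step : ∀ {s s' e} → Closure b s → obs e ≡ false → Tr e s s' → Closure b s'

  b₀ : Belief
  b₀ = Init

  R : Belief → Event → Belief
  R b e s' = ∃ λ s → Closure b s × Tr e s s'

  -- alarm variable A_φ for φ = ExactDel(A_φ, β, 0): true in b iff all s ∈ b satisfy β
  Alarm : Pred State 0ℓ → Belief → Set
  Alarm β b = ∀ s → b s → β s

  -- Traces of the asynchronous product D_φ ⊗ P: sequences of product states
  -- (bel i , st i) and events ev i.
  record ProdTrace : Set₁ where
    field
      bel : ℕ → Belief
      st  : ℕ → State
      ev  : ℕ → Event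
      init-bel : bel 0 ≐ b₀
      init-st  : Init (st 0)
      step-st  : ∀ i → Tr (ev i) (st i) (st (suc i))
      step-bel : ∀ i → if obs (ev i)
                         then bel (suc i) ≐ R (bel i) (ev i)
                         else bel (suc i) ≐ bel i

  YObs : ProdTrace → ℕ → Set
  YObs σ zero    = ⊥
  YObs σ (suc i) = obs (ProdTrace.ev σ i) ≡ true

  SatGAlarmImpl : Pred State 0ℓ → Set₁
  SatGAlarmImpl β = ∀ (σ : ProdTrace) (i : ℕ) →
    (Alarm β (ProdTrace.bel σ i) × YObs σ i) → β (ProdTrace.st σ i)

-- The diagnoser's belief is sound: the closure b* of the current belief always
-- contains the actual plant state, since unobservable plant moves stay inside
-- b* and an observable move lands in R(b, e).  Right after an observable event
-- the plant state therefore lies in the belief b itself, so an alarm (every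
-- state of b satisfies β) forces β on the plant.
module Submission where

open import Level using (0ℓ)
open import Relation.Unary using (Pred; _⊆_)
open import Defs
open import Data.Nat using (zero; suc)
open import Data.Bool using (true; false)
open import Data.Product using (_,_; proj₂)
open import Relation.Binary.PropositionalEquality using (_≡_; refl)

Closure-mono : ∀ (P : Plant) {b b′ : Belief P} → b ⊆ b′ → Closure P b ⊆ Closure P b′
Closure-mono P b⊆b′ (base s∈b)       = base (b⊆b′ s∈b)
Closure-mono P b⊆b′ (step c unobs t) = step (Closure-mono P b⊆b′ c) unobs t

module _ (P : Plant) (σ : ProdTrace P) where
  open Plant P
  open ProdTrace σ

  st∈closure-bel : ∀ i → Closure P (bel i) (st i)
  st∈closure-bel zero = base (proj₂ init-bel init-st)
  st∈closure-bel (suc i) with obs (ev i) in obs-eq | step-bel i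
  ... | true  | (_ , R⊆bel′) = base (R⊆bel′ (st i , st∈closure-bel i , step-st i))
  ... | false | (_ , bel⊆bel′) =
    step (Closure-mono P bel⊆bel′ (st∈closure-bel i)) obs-eq (step-st i)

  st∈bel-after-obs : ∀ i → obs (ev i) ≡ true → bel (suc i) (st (suc i))
  st∈bel-after-obs i o with obs (ev i) | step-bel i
  st∈bel-after-obs i refl | true | (_ , R⊆bel′) =
    R⊆bel′ (st i , st∈closure-bel i , step-st i)

theorem6p5 : (P : Plant) (β : Pred (State P) 0ℓ) → SatGAlarmImpl P β
theorem6p5 P β σ zero    (_     , ())
theorem6p5 P β σ (suc i) (alarm , o) = alarm _ (st∈bel-after-obs P σ i o)
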